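{- Let $T$ be a p-string whose last symbol is $\$$ and in which $\$$ occurs nowhere else. For any integers $i,j$ with $1\le i<j\le |T|$, if $\mathsf{L}_T[i]=\mathsf{L}_T[j]$ then $\mathsf{LF}_T(i)<\mathsf{LF}_T(j)$.
   Context: $\Sigma_s$ (s-symbols) and $\Sigma_p$ (p-symbols) are disjoint alphabets; a p-string is a string over $\Sigma_s\cup\Sigma_p$; $\$$ is the smallest s-symbol. Strings are 1-indexed; $w[i..]$ is the suffix starting at $i$. $\infty$ is larger than every integer; the alphabet $\Sigma_s\cup\{1,2,\dots\}\cup\{\infty\}$ is totally ordered with every s-symbol smaller than every integer and $\infty$; strings are compared lexicographically. The p-encoding $\langle w\rangle$ of a p-string $w$: $\langle w\rangle[i]=w[i]$ if $w[i]\in\Sigma_s$; $\infty$ if $w[i]\in\Sigma_p$ does not occur in $w[..i-1]$; otherwise $i-j$ with $j<i$ the largest position with $w[j]=w[i]$. $|w|_p$ is the number of distinct p-symbols in $w$; $\mathsf{select}_c(w,i)$ is the position of the $i$-th occurrence of $c$ in $w$. For nonempty $w$, $\mathrm{fce}(w)=w[1]$ if $w[1]\in\Sigma_s$, and otherwise $\mathrm{fce}(w)=|w[..h+1]|_p$ with $h+1=\min\{|w|,\mathsf{select}_{w[1]}(w,2)\}$. The suffix rank $\mathsf{R}_T(i)$ is the lexicographic rank of $\langle T[i..]\rangle$ in $\{\langle T[j..]\rangle : 1\le j\le |T|\}$, and $\mathsf{R}^{ -1}_T$ is its inverse. $\mathsf{L}_T$ is the string of length $|T|$ with $\mathsf{L}_T[i]=\mathrm{fce}(T[\mathsf{R}^{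 -1}_T(i)-1..])$, where by convention $T[0..]$ denotes the string $\$$. $\mathsf{LF}_T(i)=\mathsf{R}_T(\mathsf{R}^{ -1}_T(i)-1)$ if $\mathsf{R}^{ -1}_T(i)>1$, and $\mathsf{LF}_T(i)=\mathsf{R}_T(|T|)=1$ otherwise. -}

module Defs where

open import Data.Nat using (ℕ; zero; suc; _+_; _∸_; _<ᵇ_; _≡ᵇ_)
open import Data.Bool using (Bool; true; false; if_then_else_)
open import Data.Sum using (_⊎_; inj₁; inj₂)
open import Data.Maybe using (Maybe; just; nothing)
open import Data.List using (List; []; _∷_; length; drop; deduplicate)
open import Relation.Binary.PropositionalEquality using (_≡_)
open import Relation.Binary.Definitions using (DecidableEquality; tri<; tri≈; tri>)
open import Relation.Binary.Structures using (IsStrictTotalOrder)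
open import Relation.Nullary using (yes; no)

-- A p-symbol is an element of  S ⊎ P  (inj₁ = s-symbol, inj₂ = p-symbol), so the two
-- alphabets are disjoint by construction; a p-string is a  List (S ⊎ P).
module PString
  (S : Set) (_<ₛ_ : S → S → Set) (sto : IsStrictTotalOrder _≡_ _<ₛ_)
  ($ : S)
  (P : Set) (_≟ₚ_ : DecidableEquality P) where

  Sym : Set
  Sym = S ⊎ P

  PStr : Set
  PStr = List Sym

  data Enc : Set where
    s   : S → Enc
    num : ℕ → Enc
    ∞   : Enc

  open IsStrictTotalOrder sto using (compare)

  encLt : Enc → Enc → Bool
  encLt (s a) (s b) with compare a b
  ... | tri< _ _ _ = true
  ... | tri≈ _ _ _ = false
  ... | tri> _ _ _ = false
  encLt (s _) (num _) = true
  encLt (s _) ∞ = true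
  encLt (num _) (s _) = false
  encLt (num m) (num n) = m <ᵇ n
  encLt (num _) ∞ = true
  encLt ∞ _ = false

  lexLt : List Enc → List Enc → Bool
  lexLt [] [] = false
  lexLt [] (_ ∷ _) = true
  lexLt (_ ∷ _) [] = false
  lexLt (a ∷ as) (b ∷ bs) =
    if encLt a b then true else (if encLt b a then false else lexLt as bs)

  -- distance from the current position to the most recent previous occurrence of
  -- the p-symbol c; the previous symbols are given in reverse order (nearest first)
  prevDist : P → List Sym → Maybe ℕ
  prevDist c [] = nothing
  prevDist c (inj₁ _ ∷ r) = Data.Maybe.map suc (prevDist c r)
  prevDist c (inj₂ d ∷ r) with c ≟ₚ d
  ... | yes _ = just 1
  ... | no _ = Data.Maybe.map suc (prevDist c r)

  encodeFrom : List Sym → PStr → List Enc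
  encodeFrom rev [] = []
  encodeFrom rev (inj₁ a ∷ w) = s a ∷ encodeFrom (inj₁ a ∷ rev) w
  encodeFrom rev (inj₂ c ∷ w) with prevDist c rev
  ... | nothing = ∞ ∷ encodeFrom (inj₂ c ∷ rev) w
  ... | just k  = num k ∷ encodeFrom (inj₂ c ∷ rev) w

  ⟨_⟩ : PStr → List Enc
  ⟨ w ⟩ = encodeFrom [] w

  pSyms : PStr → List P
  pSyms [] = []
  pSyms (inj₁ _ ∷ w) = pSyms w
  pSyms (inj₂ c ∷ w) = c ∷ pSyms w

  ∣_∣ₚ : PStr → ℕ
  ∣ w ∣ₚ = length (deduplicate _≟ₚ_ (pSyms w))

  upToOcc : P → PStr → PStr
  upToOcc c [] = []
  upToOcc c (inj₁ a ∷ w) = inj₁ a ∷ upToOcc c w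
  upToOcc c (inj₂ d ∷ w) with c ≟ₚ d
  ... | yes _ = inj₂ d ∷ []
  ... | no _ = inj₂ d ∷ upToOcc c w

  -- For w = c ∷ w' with c a p-symbol, w[..h+1] = c ∷ upToOcc c w', where
  -- h+1 = min{|w|, select_c(w,2)}.  (fce [] is never used; it is set to $.)
  fce : PStr → S ⊎ ℕ
  fce [] = inj₁ $
  fce (inj₁ a ∷ _) = inj₁ a
  fce (inj₂ c ∷ w) = inj₂ ∣ inj₂ c ∷ upToOcc c w ∣ₚ

  -- T[i..] for 1-indexed i ≥ 1
  suf : PStr → ℕ → PStr
  suf T i = drop (i ∸ 1) T

  suf₀ : PStr → ℕ → PStr
  suf₀ T zero = inj₁ $ ∷ []
  suf₀ T (suc k) = suf T (suc k)

  countUpTo : ℕ → (ℕ → Bool) → ℕ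
  countUpTo zero f = 0
  countUpTo (suc n) f = (if f (suc n) then 1 else 0) + countUpTo n f

  R : PStr → ℕ → ℕ
  R T i = suc (countUpTo (length T) (λ j → lexLt ⟨ suf T j ⟩ ⟨ suf T i ⟩))

  findRank : PStr → ℕ → ℕ → ℕ
  findRank T r zero = 0
  findRank T r (suc n) = if R T (suc n) ≡ᵇ r then suc n else findRank T r n

  Rinv : PStr → ℕ → ℕ
  Rinv T r = findRank T r (length T)

  L : PStr → ℕ → S ⊎ ℕ
  L T i = fce (suf₀ T (Rinv T i ∸ 1))

  LF : PStr → ℕ → ℕ
  LF T i with Rinv T i
  ... | zero = 1
  ... | suc zero = 1
  ... | suc (suc k) = R T (suc k)

module Submission where

-- Prepending a symbol x to a p-string u changes the p-encoding in a controlled way.  If x is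
-- an s-symbol, ⟨x u⟩ is x followed by ⟨u⟩.  If x = c is a p-symbol, ⟨c u⟩ is ∞ followed by ⟨u⟩
-- in which only the fce(c u)-th ∞ (the one marking the first occurrence of c in u, if any) is
-- replaced by its position.  An integer at position p of a p-encoding is always smaller than p,
-- so for a fixed index this replacement preserves the lexicographic order.  Hence if ⟨u⟩ < ⟨v⟩
-- and fce(x u) = fce(y v), then ⟨x u⟩ < ⟨y v⟩, which is the claimed monotonicity of LF once the
-- suffix rank R is known to be a bijection.  Position 1 needs no such argument: its L-value is
-- $, which is the L-value of no other position since $ occurs only at the end of T.

open import Defs
open import Data.Bool using (Bool; true; false; T; not; _∧_; if_then_else_)
open import Data.Bool.Properties using (∧-assoc; ∧-comm; ∧-zeroʳ; ∧-identityʳ)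
open import Data.Unit using (⊤)
open import Data.Fin using (Fin; toℕ; fromℕ<; punchOut; _≟_)
open import Data.Fin.Properties
  using (any?; punchOut-injective; injective⇒≤; toℕ-injective; toℕ-fromℕ<; fromℕ<-injective; toℕ<n)
open import Data.List using (List; []; _∷_; [_]; _++_; length; drop; filter; deduplicate)
open import Data.List.Membership.Propositional using (_∉_)
open import Data.List.Properties using (length-++; length-drop)
open import Data.List.Relation.Binary.Lex.Strict
  using (Lex-<; halt; this; next; <-isStrictTotalOrder)
open import Data.List.Relation.Binary.Pointwise as Pointwise using (Pointwise-≡⇒≡)
open import Data.List.Relation.Unary.Any using (here; there)
open import Data.Maybe using (Maybe; just; nothing; map; maybe′; is-nothing)
open import Data.Nat using (ℕ; zero; suc; _+_; _∸_; _≤_; _<_; _≡ᵇ_; z≤n; s≤s; s≤s⁻¹)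
open import Data.Nat.Properties
  using ( ≤-refl; ≤-trans; <⇒≤; <⇒≢; ≤∧≢⇒<; <-asym; <-trans; <-cmp; +-comm; +-mono-≤; +-mono-≤-<
        ; m≤n⇒m<n∨m≡n; 1+n≰n; suc-injective; ∸-cancelˡ-≡; <ᵇ⇒<; <⇒<ᵇ; ≡ᵇ⇒≡; ≡⇒≡ᵇ )
open import Data.Product using (∃; _×_; _,_; proj₂)
open import Data.Sum using (inj₁; inj₂)
open import Data.Sum.Properties using (inj₂-injective)
open import Function using (_∘_; Injective)
open import Relation.Binary.Consequences using (tri⇒irr)
open import Relation.Binary.Definitions using (DecidableEquality; Trichotomous; tri<; tri≈; tri>)
open import Relation.Binary.PropositionalEquality
  using ( _≡_; _≢_; refl; sym; trans; cong; cong₂; subst; subst₂; resp₂; isEquivalence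
        ; module ≡-Reasoning )
open import Relation.Binary.Structures using (IsStrictTotalOrder)
open import Relation.Nullary using (¬_; yes; no; does; ¬?; contradiction)

Fin-injective⇒surjective : ∀ {n} (f : Fin n → Fin n) → Injective _≡_ _≡_ f → ∀ r → ∃ λ p → f p ≡ r
Fin-injective⇒surjective {suc n} f f-inj r with any? (λ p → f p ≟ r)
... | yes hit = hit
... | no miss = contradiction (injective⇒≤ avoid-r-injective) 1+n≰n
  where
  avoid-r : Fin (suc n) → Fin n
  avoid-r p = punchOut {i = r} {j = f p} (λ r≡fp → miss (p , sym r≡fp))
  avoid-r-injective : Injective _≡_ _≡_ avoid-r
  avoid-r-injective = f-inj ∘ punchOut-injective {i = r} _ _

drop-∷ : ∀ {A : Set} k (xs : List A) → k < length xs → ∃ λ x → drop k xs ≡ x ∷ drop (suc k) xs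
drop-∷ zero (x ∷ xs) _ = x , refl
drop-∷ (suc k) (_ ∷ xs) (s≤s k<n) = drop-∷ k xs k<n

module PStringProperties
  (S : Set) (_<ₛ_ : S → S → Set) (sto : IsStrictTotalOrder _≡_ _<ₛ_)
  ($ : S) (P : Set) (_≟ₚ_ : DecidableEquality P) where

  open PString S _<ₛ_ sto $ P _≟ₚ_
  open IsStrictTotalOrder sto using (compare) renaming (trans to <ₛ-trans)

  -- The order on p-encodings

  infix 4 _<ᵉ_ _<ˡ_

  _<ᵉ_ : Enc → Enc → Set
  a <ᵉ b = T (encLt a b)

  s<ᵉs⇒<ₛ : ∀ {a b} → s a <ᵉ s b → a <ₛ b
  s<ᵉs⇒<ₛ {a} {b} lt with compare a b
  ... | tri< a<b _ _ = a<b

  <ₛ⇒s<ᵉs : ∀ {a b} → a <ₛ b → s a <ᵉ s b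
  <ₛ⇒s<ᵉs {a} {b} a<b with compare a b
  ... | tri< _ _ _ = _
  ... | tri≈ ¬a<b _ _ = ¬a<b a<b
  ... | tri> ¬a<b _ _ = ¬a<b a<b

  <ᵉ-trans : ∀ {a b c} → a <ᵉ b → b <ᵉ c → a <ᵉ c
  <ᵉ-trans {s _}   {s _}   {s _}   a<b b<c = <ₛ⇒s<ᵉs (<ₛ-trans (s<ᵉs⇒<ₛ a<b) (s<ᵉs⇒<ₛ b<c))
  <ᵉ-trans {s _}   {s _}   {num _} _   _   = _
  <ᵉ-trans {s _}   {s _}   {∞}     _   _   = _
  <ᵉ-trans {s _}   {num _} {num _} _   _   = _
  <ᵉ-trans {s _}   {num _} {∞}     _   _   = _
  <ᵉ-trans {num m} {num n} {num k} m<n n<k = <⇒<ᵇ (<-trans (<ᵇ⇒< m n m<n) (<ᵇ⇒< n k n<k))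
  <ᵉ-trans {num _} {num _} {∞}     _   _   = _

  <ᵉ-compare : Trichotomous _≡_ _<ᵉ_
  <ᵉ-compare (s a) (s b) with compare a b
  ... | tri< _ a≢b b≮a = tri< _ (λ { refl → a≢b refl }) (b≮a ∘ s<ᵉs⇒<ₛ)
  ... | tri≈ _ a≡b b≮a = tri≈ (λ ()) (cong s a≡b) (b≮a ∘ s<ᵉs⇒<ₛ)
  ... | tri> _ a≢b b<a = tri> (λ ()) (λ { refl → a≢b refl }) (<ₛ⇒s<ᵉs b<a)
  <ᵉ-compare (s _) (num _) = tri< _ (λ ()) (λ ())
  <ᵉ-compare (s _) ∞ = tri< _ (λ ()) (λ ())
  <ᵉ-compare (num _) (s _) = tri> (λ ()) (λ ()) _
  <ᵉ-compare (num m) (num n) with <-cmp m n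
  ... | tri< m<n m≢n n≮m = tri< (<⇒<ᵇ m<n) (λ { refl → m≢n refl }) (n≮m ∘ <ᵇ⇒< n m)
  ... | tri≈ m≮n refl n≮m = tri≈ (m≮n ∘ <ᵇ⇒< m n) refl (n≮m ∘ <ᵇ⇒< n m)
  ... | tri> m≮n m≢n n<m = tri> (m≮n ∘ <ᵇ⇒< m n) (λ { refl → m≢n refl }) (<⇒<ᵇ n<m)
  <ᵉ-compare (num _) ∞ = tri< _ (λ ()) (λ ())
  <ᵉ-compare ∞ (s _) = tri> (λ ()) (λ ()) _
  <ᵉ-compare ∞ (num _) = tri> (λ ()) (λ ()) _
  <ᵉ-compare ∞ ∞ = tri≈ (λ ()) refl (λ ())

  <ᵉ-isStrictTotalOrder : IsStrictTotalOrder _≡_ _<ᵉ_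
  <ᵉ-isStrictTotalOrder = record
    { isStrictPartialOrder = record
      { isEquivalence = isEquivalence
      ; irrefl = λ {a} {b} → tri⇒irr <ᵉ-compare {a} {b}
      ; trans = λ {a} {b} {c} → <ᵉ-trans {a} {b} {c}
      ; <-resp-≈ = resp₂ _<ᵉ_
      }
    ; compare = <ᵉ-compare
    }

  <ᵉ-irrefl : ∀ a → ¬ a <ᵉ a
  <ᵉ-irrefl a = tri⇒irr <ᵉ-compare {a} {a} refl

  _<ˡ_ : List Enc → List Enc → Set
  _<ˡ_ = Lex-< _≡_ _<ᵉ_

  open IsStrictTotalOrder (<-isStrictTotalOrder <ᵉ-isStrictTotalOrder)
    using () renaming (trans to <ˡ-trans; compare to <ˡ-compare; irrefl to <ˡ-irrefl′)

  <ˡ-irrefl : ∀ A → ¬ A <ˡ A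
  <ˡ-irrefl A = <ˡ-irrefl′ (Pointwise.refl refl)

  encLt-false : ∀ {a b} → ¬ a <ᵉ b → encLt a b ≡ false
  encLt-false {a} {b} a≮b with encLt a b
  ... | true = contradiction _ a≮b
  ... | false = refl

  encLt-false⇒≡ : ∀ {a b} → encLt a b ≡ false → encLt b a ≡ false → a ≡ b
  encLt-false⇒≡ {a} {b} a≮b b≮a with <ᵉ-compare a b
  ... | tri< a<b _ _ = contradiction (subst T a≮b a<b) (λ ())
  ... | tri≈ _ a≡b _ = a≡b
  ... | tri> _ _ b<a = contradiction (subst T b≮a b<a) (λ ())

  lexLt⇒<ˡ : ∀ {A B} → T (lexLt A B) → A <ˡ B
  lexLt⇒<ˡ {[]} {_ ∷ _} _ = halt
  lexLt⇒<ˡ {a ∷ A} {b ∷ B} lt with encLt a b in ab | encLt b a in ba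
  ... | true  | _     = this (subst T (sym ab) _)
  ... | false | false = next (encLt-false⇒≡ ab ba) (lexLt⇒<ˡ lt)

  <ˡ⇒lexLt : ∀ {A B} → A <ˡ B → T (lexLt A B)
  <ˡ⇒lexLt halt = _
  <ˡ⇒lexLt {a ∷ _} {b ∷ _} (this a<b) with encLt a b
  ... | true = _
  <ˡ⇒lexLt {a ∷ _} (next refl lt) rewrite encLt-false {a} {a} (<ᵉ-irrefl a) = <ˡ⇒lexLt lt

  -- Prepending a symbol to a p-string

  -- fill k m e replaces the (k+1)-st ∞ of e by its position, positions of e being numbered from m.
  fill : ℕ → ℕ → List Enc → List Enc
  fill k m [] = []
  fill k m (s a ∷ e) = s a ∷ fill k (suc m) e
  fill k m (num n ∷ e) = num n ∷ fill k (suc m) e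
  fill zero m (∞ ∷ e) = num m ∷ e
  fill (suc k) m (∞ ∷ e) = ∞ ∷ fill k (suc m) e

  Bounded : ℕ → List Enc → Set
  Bounded m [] = ⊤
  Bounded m (s _ ∷ e) = Bounded (suc m) e
  Bounded m (num n ∷ e) = n < m × Bounded (suc m) e
  Bounded m (∞ ∷ e) = Bounded (suc m) e

  -- At the filled position the new value num m exceeds every integer a Bounded list has there.
  fill-mono : ∀ k m {A B} → Bounded m A → A <ˡ B → fill k m A <ˡ fill k m B
  fill-mono k       m {[]} {s _ ∷ _}   _ halt = halt
  fill-mono k       m {[]} {num _ ∷ _} _ halt = halt
  fill-mono zero    m {[]} {∞ ∷ _}     _ halt = halt
  fill-mono (suc k) m {[]} {∞ ∷ _}     _ halt = halt
  fill-mono k       m {s _ ∷ _}   {s _ ∷ _}   _ (this a<b) = this a<b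
  fill-mono k       m {s _ ∷ _}   {num _ ∷ _} _ (this _) = this _
  fill-mono zero    m {s _ ∷ _}   {∞ ∷ _}     _ (this _) = this _
  fill-mono (suc k) m {s _ ∷ _}   {∞ ∷ _}     _ (this _) = this _
  fill-mono k       m {num _ ∷ _} {num _ ∷ _} _ (this a<b) = this a<b
  fill-mono zero    m {num n ∷ _} {∞ ∷ _}     (n<m , _) (this _) = this (<⇒<ᵇ n<m)
  fill-mono (suc k) m {num _ ∷ _} {∞ ∷ _}     _ (this _) = this _
  fill-mono k       m {s _ ∷ _}   bd (next refl A<B) = next refl (fill-mono k (suc m) bd A<B)
  fill-mono k       m {num _ ∷ _} (_ , bd) (next refl A<B) = next refl (fill-mono k (suc m) bd A<B)
  fill-mono zero    m {∞ ∷ _}     _ (next refl A<B) = next refl A<B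
  fill-mono (suc k) m {∞ ∷ _}     bd (next refl A<B) = next refl (fill-mono k (suc m) bd A<B)

  encodeFrom-∷ᵖ : ∀ rev c u →
    encodeFrom rev (inj₂ c ∷ u) ≡ maybe′ num ∞ (prevDist c rev) ∷ encodeFrom (inj₂ c ∷ rev) u
  encodeFrom-∷ᵖ rev c u with prevDist c rev
  ... | nothing = refl
  ... | just _ = refl

  prevDist-∷ᵖ-≢ : ∀ {z c} rev → z ≢ c → prevDist z (inj₂ c ∷ rev) ≡ map suc (prevDist z rev)
  prevDist-∷ᵖ-≢ {z} {c} rev z≢c with z ≟ₚ c
  ... | yes z≡c = contradiction z≡c z≢c
  ... | no _ = refl

  prevDist-∷ᵖ-cong : ∀ c r₁ r₂ → (∀ z → z ≢ c → prevDist z r₁ ≡ prevDist z r₂) →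
    ∀ z → prevDist z (inj₂ c ∷ r₁) ≡ prevDist z (inj₂ c ∷ r₂)
  prevDist-∷ᵖ-cong c r₁ r₂ same z with z ≟ₚ c
  ... | yes _ = refl
  ... | no z≢c = cong (map suc) (same z z≢c)

  encodeFrom-cong : ∀ r₁ r₂ u → (∀ z → prevDist z r₁ ≡ prevDist z r₂) →
    encodeFrom r₁ u ≡ encodeFrom r₂ u
  encodeFrom-cong r₁ r₂ [] same = refl
  encodeFrom-cong r₁ r₂ (inj₁ a ∷ u) same =
    cong (s a ∷_) (encodeFrom-cong (inj₁ a ∷ r₁) (inj₁ a ∷ r₂) u (cong (map suc) ∘ same))
  encodeFrom-cong r₁ r₂ (inj₂ c ∷ u) same = begin
    encodeFrom r₁ (inj₂ c ∷ u)
      ≡⟨ encodeFrom-∷ᵖ r₁ c u ⟩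
    maybe′ num ∞ (prevDist c r₁) ∷ encodeFrom (inj₂ c ∷ r₁) u
      ≡⟨ cong₂ _∷_ (cong (maybe′ num ∞) (same c))
           (encodeFrom-cong _ _ u (prevDist-∷ᵖ-cong c r₁ r₂ (λ z _ → same z))) ⟩
    maybe′ num ∞ (prevDist c r₂) ∷ encodeFrom (inj₂ c ∷ r₂) u
      ≡⟨ encodeFrom-∷ᵖ r₂ c u ⟨
    encodeFrom r₂ (inj₂ c ∷ u) ∎
    where open ≡-Reasoning

  prevDist-snoc-≢ : ∀ {z c} rev → z ≢ c → prevDist z (rev ++ [ inj₂ c ]) ≡ prevDist z rev
  prevDist-snoc-≢ [] z≢c = prevDist-∷ᵖ-≢ [] z≢c
  prevDist-snoc-≢ (inj₁ _ ∷ rev) z≢c = cong (map suc) (prevDist-snoc-≢ rev z≢c)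
  prevDist-snoc-≢ {z} (inj₂ d ∷ rev) z≢c with z ≟ₚ d
  ... | yes _ = refl
  ... | no _ = cong (map suc) (prevDist-snoc-≢ rev z≢c)

  prevDist-snoc-≡ : ∀ c rev → prevDist c rev ≡ nothing →
    prevDist c (rev ++ [ inj₂ c ]) ≡ just (suc (length rev))
  prevDist-snoc-≡ c [] _ with c ≟ₚ c
  ... | yes _ = refl
  ... | no c≢c = contradiction refl c≢c
  prevDist-snoc-≡ c (inj₁ _ ∷ rev) c∉rev with prevDist c rev in eq
  ... | nothing = cong (map suc) (prevDist-snoc-≡ c rev eq)
  prevDist-snoc-≡ c (inj₂ d ∷ rev) c∉rev with c ≟ₚ d
  ... | no _ with prevDist c rev in eq
  ...   | nothing = cong (map suc) (prevDist-snoc-≡ c rev eq)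

  prevDist-≤ : ∀ c rev {k} → prevDist c rev ≡ just k → k ≤ length rev
  prevDist-≤ c (inj₁ _ ∷ rev) found with prevDist c rev in eq
  prevDist-≤ c (inj₁ _ ∷ rev) refl | just _ = s≤s (prevDist-≤ c rev eq)
  prevDist-≤ c (inj₂ d ∷ rev) found with c ≟ₚ d
  prevDist-≤ c (inj₂ d ∷ rev) refl | yes _ = s≤s z≤n
  ... | no _ with prevDist c rev in eq
  prevDist-≤ c (inj₂ d ∷ rev) refl | no _ | just _ = s≤s (prevDist-≤ c rev eq)

  encodeFrom-bounded : ∀ rev u → Bounded (suc (length rev)) (encodeFrom rev u)
  encodeFrom-bounded rev [] = _
  encodeFrom-bounded rev (inj₁ a ∷ u) = encodeFrom-bounded (inj₁ a ∷ rev) u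
  encodeFrom-bounded rev (inj₂ c ∷ u) with prevDist c rev in eq
  ... | nothing = encodeFrom-bounded (inj₂ c ∷ rev) u
  ... | just _ = s≤s (prevDist-≤ c rev eq) , encodeFrom-bounded (inj₂ c ∷ rev) u

  _≠ᵇ_ : P → P → Bool
  c ≠ᵇ y = not (does (c ≟ₚ y))

  ≠ᵇ-irrefl : ∀ c → c ≠ᵇ c ≡ false
  ≠ᵇ-irrefl c with c ≟ₚ c
  ... | yes _ = refl
  ... | no c≢c = contradiction refl c≢c

  ≢⇒≠ᵇ : ∀ {c y} → c ≢ y → c ≠ᵇ y ≡ true
  ≢⇒≠ᵇ {c} {y} c≢y with c ≟ₚ y
  ... | yes c≡y = contradiction c≡y c≢y
  ... | no _ = refl

  count : (P → Bool) → List P → ℕ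
  count q [] = 0
  count q (x ∷ xs) = (if q x then 1 else 0) + count q xs

  count-cong : ∀ {q q′} → (∀ y → q y ≡ q′ y) → ∀ xs → count q xs ≡ count q′ xs
  count-cong q≗q′ [] = refl
  count-cong q≗q′ (x ∷ xs) = cong₂ _+_ (cong (if_then 1 else 0) (q≗q′ x)) (count-cong q≗q′ xs)

  length-filter-≢ : ∀ c zs → length (filter (¬? ∘ (c ≟ₚ_)) zs) ≡ count (c ≠ᵇ_) zs
  length-filter-≢ c [] = refl
  length-filter-≢ c (z ∷ zs) with c ≟ₚ z
  ... | yes _ = length-filter-≢ c zs
  ... | no _ = cong suc (length-filter-≢ c zs)

  count-filter-≢ : ∀ q x zs → count q (filter (¬? ∘ (x ≟ₚ_)) zs) ≡ count (λ y → q y ∧ x ≠ᵇ y) zs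
  count-filter-≢ q x [] = refl
  count-filter-≢ q x (z ∷ zs) with x ≟ₚ z
  ... | yes _ rewrite ∧-zeroʳ (q z) = count-filter-≢ q x zs
  ... | no _ rewrite ∧-identityʳ (q z) = cong ((if q z then 1 else 0) +_) (count-filter-≢ q x zs)

  is-nothing-map-suc : ∀ (d : Maybe ℕ) → is-nothing (map suc d) ≡ is-nothing d
  is-nothing-map-suc nothing = refl
  is-nothing-map-suc (just _) = refl

  unseen : List Sym → P → Bool
  unseen rev y = is-nothing (prevDist y rev)

  unseen-∷ᵖ : ∀ z rev y → unseen (inj₂ z ∷ rev) y ≡ unseen rev y ∧ z ≠ᵇ y
  unseen-∷ᵖ z rev y with y ≟ₚ z
  ... | yes refl rewrite ≠ᵇ-irrefl y = sym (∧-zeroʳ (unseen rev y))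
  ... | no y≢z rewrite ≢⇒≠ᵇ (y≢z ∘ sym) =
    trans (is-nothing-map-suc (prevDist y rev)) (sym (∧-identityʳ (unseen rev y)))

  fresh : P → List Sym → P → Bool
  fresh c rev y = unseen rev y ∧ c ≠ᵇ y

  fresh-∷ᵖ : ∀ c z rev y → fresh c (inj₂ z ∷ rev) y ≡ fresh c rev y ∧ z ≠ᵇ y
  fresh-∷ᵖ c z rev y = begin
    unseen (inj₂ z ∷ rev) y ∧ c ≠ᵇ y ≡⟨ cong (_∧ c ≠ᵇ y) (unseen-∷ᵖ z rev y) ⟩
    (unseen rev y ∧ z ≠ᵇ y) ∧ c ≠ᵇ y ≡⟨ ∧-assoc (unseen rev y) (z ≠ᵇ y) (c ≠ᵇ y) ⟩
    unseen rev y ∧ (z ≠ᵇ y ∧ c ≠ᵇ y) ≡⟨ cong (unseen rev y ∧_) (∧-comm (z ≠ᵇ y) (c ≠ᵇ y)) ⟩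
    unseen rev y ∧ (c ≠ᵇ y ∧ z ≠ᵇ y) ≡⟨ ∧-assoc (unseen rev y) (c ≠ᵇ y) (z ≠ᵇ y) ⟨
    (unseen rev y ∧ c ≠ᵇ y) ∧ z ≠ᵇ y ∎
    where open ≡-Reasoning

  count-fresh-self : ∀ c rev → count (fresh c rev) [ c ] ≡ 0
  count-fresh-self c rev rewrite ≠ᵇ-irrefl c | ∧-zeroʳ (unseen rev c) = refl

  count-fresh-dedup-∷ : ∀ {c z} rev ys → c ≢ z →
    count (fresh c rev) (deduplicate _≟ₚ_ (z ∷ ys))
      ≡ (if unseen rev z then 1 else 0) + count (fresh c (inj₂ z ∷ rev)) (deduplicate _≟ₚ_ ys)
  count-fresh-dedup-∷ {c} {z} rev ys c≢z = cong₂ _+_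
    (cong (if_then 1 else 0)
      (trans (cong (unseen rev z ∧_) (≢⇒≠ᵇ c≢z)) (∧-identityʳ (unseen rev z))))
    (trans (count-filter-≢ (fresh c rev) z (deduplicate _≟ₚ_ ys))
           (count-cong (λ y → sym (fresh-∷ᵖ c z rev y)) (deduplicate _≟ₚ_ ys)))

  fill-maybe : ∀ k m d e →
    fill ((if is-nothing d then 1 else 0) + k) m (maybe′ num ∞ d ∷ e)
      ≡ maybe′ num ∞ d ∷ fill k (suc m) e
  fill-maybe k m nothing e = refl
  fill-maybe k m (just _) e = refl

  -- rev lists the symbols read so far, nearest first, so rev ++ [ inj₂ c ] is that history with c
  -- read before all of it.  Each distinct p-symbol before the first c in u that is new to rev is
  -- encoded by one ∞, so the first c is the ∞ with the index below.
  encodeFrom-snoc : ∀ c rev u → prevDist c rev ≡ nothing →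
    encodeFrom (rev ++ [ inj₂ c ]) u
      ≡ fill (count (fresh c rev) (deduplicate _≟ₚ_ (pSyms (upToOcc c u))))
             (suc (length rev)) (encodeFrom rev u)
  encodeFrom-snoc c rev [] _ = refl
  encodeFrom-snoc c rev (inj₁ a ∷ u) unseen-c = cong (s a ∷_) (trans
    (encodeFrom-snoc c (inj₁ a ∷ rev) u (cong (map suc) unseen-c))
    (cong (λ k → fill k (suc (suc (length rev))) (encodeFrom (inj₁ a ∷ rev) u))
      (count-cong (λ y → cong (_∧ c ≠ᵇ y) (is-nothing-map-suc (prevDist y rev)))
        (deduplicate _≟ₚ_ (pSyms (upToOcc c u))))))
  encodeFrom-snoc c rev (inj₂ z ∷ u) unseen-c with c ≟ₚ z
  ... | yes refl = begin
    encodeFrom (rev ++ [ inj₂ c ]) (inj₂ c ∷ u)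
      ≡⟨ encodeFrom-∷ᵖ (rev ++ [ inj₂ c ]) c u ⟩
    maybe′ num ∞ (prevDist c (rev ++ [ inj₂ c ])) ∷ encodeFrom (inj₂ c ∷ rev ++ [ inj₂ c ]) u
      ≡⟨ cong₂ _∷_ (cong (maybe′ num ∞) (prevDist-snoc-≡ c rev unseen-c))
                   (encodeFrom-cong _ _ u (prevDist-∷ᵖ-cong c _ rev (λ _ → prevDist-snoc-≢ rev))) ⟩
    num m ∷ encodeFrom (inj₂ c ∷ rev) u
      ≡⟨ cong (λ d → fill 0 m (maybe′ num ∞ d ∷ encodeFrom (inj₂ c ∷ rev) u)) unseen-c ⟨
    fill 0 m (maybe′ num ∞ (prevDist c rev) ∷ encodeFrom (inj₂ c ∷ rev) u)
      ≡⟨ cong₂ (λ k e → fill k m e) (count-fresh-self c rev) (encodeFrom-∷ᵖ rev c u) ⟨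
    fill (count (fresh c rev) [ c ]) m (encodeFrom rev (inj₂ c ∷ u)) ∎
    where
    open ≡-Reasoning
    m = suc (length rev)
  ... | no c≢z = begin
    encodeFrom (rev ++ [ inj₂ c ]) (inj₂ z ∷ u)
      ≡⟨ encodeFrom-∷ᵖ (rev ++ [ inj₂ c ]) z u ⟩
    maybe′ num ∞ (prevDist z (rev ++ [ inj₂ c ])) ∷ encodeFrom (inj₂ z ∷ rev ++ [ inj₂ c ]) u
      ≡⟨ cong₂ _∷_ (cong (maybe′ num ∞) (prevDist-snoc-≢ rev (c≢z ∘ sym)))
                   (encodeFrom-snoc c (inj₂ z ∷ rev) u unseen-c′) ⟩
    maybe′ num ∞ d ∷ fill k′ (suc m) e
      ≡⟨ fill-maybe k′ m d e ⟨
    fill ((if is-nothing d then 1 else 0) + k′) m (maybe′ num ∞ d ∷ e)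
      ≡⟨ cong₂ (λ k e → fill k m e) (count-fresh-dedup-∷ rev ys c≢z) (encodeFrom-∷ᵖ rev z u) ⟨
    fill (count (fresh c rev) (deduplicate _≟ₚ_ (z ∷ ys))) m (encodeFrom rev (inj₂ z ∷ u)) ∎
    where
    open ≡-Reasoning
    m = suc (length rev)
    d = prevDist z rev
    e = encodeFrom (inj₂ z ∷ rev) u
    ys = pSyms (upToOcc c u)
    k′ = count (fresh c (inj₂ z ∷ rev)) (deduplicate _≟ₚ_ ys)
    unseen-c′ : prevDist c (inj₂ z ∷ rev) ≡ nothing
    unseen-c′ = trans (prevDist-∷ᵖ-≢ rev c≢z) (cong (map suc) unseen-c)

  fceIndex : P → PStr → ℕ
  fceIndex c u = count (c ≠ᵇ_) (deduplicate _≟ₚ_ (pSyms (upToOcc c u)))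

  fce-∷ᵖ : ∀ c u → fce (inj₂ c ∷ u) ≡ inj₂ (suc (fceIndex c u))
  fce-∷ᵖ c u = cong (inj₂ ∘ suc) (length-filter-≢ c (deduplicate _≟ₚ_ (pSyms (upToOcc c u))))

  ⟨⟩-∷ᵖ : ∀ c u → ⟨ inj₂ c ∷ u ⟩ ≡ ∞ ∷ fill (fceIndex c u) 1 ⟨ u ⟩
  ⟨⟩-∷ᵖ c u = cong (∞ ∷_) (encodeFrom-snoc c [] u refl)

  ⟨⟩-∷-mono : ∀ x y u v → fce (x ∷ u) ≡ fce (y ∷ v) → ⟨ u ⟩ <ˡ ⟨ v ⟩ → ⟨ x ∷ u ⟩ <ˡ ⟨ y ∷ v ⟩
  ⟨⟩-∷-mono (inj₁ a) (inj₁ .a) u v refl u<v =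
    next refl (subst₂ _<ˡ_ (⟨⟩-∷ˢ u) (⟨⟩-∷ˢ v) u<v)
    where
    ⟨⟩-∷ˢ : ∀ w → ⟨ w ⟩ ≡ encodeFrom [ inj₁ a ] w
    ⟨⟩-∷ˢ w = encodeFrom-cong [] [ inj₁ a ] w (λ _ → refl)
  ⟨⟩-∷-mono (inj₂ c) (inj₂ d) u v same-fce u<v =
    subst₂ _<ˡ_ (sym (⟨⟩-∷ᵖ c u)) (sym (⟨⟩-∷ᵖ d v))
      (next refl (subst (λ k → fill (fceIndex c u) 1 ⟨ u ⟩ <ˡ fill k 1 ⟨ v ⟩) same-index
        (fill-mono (fceIndex c u) 1 (encodeFrom-bounded [] u) u<v)))
    where
    same-index : fceIndex c u ≡ fceIndex d v
    same-index =
      suc-injective (inj₂-injective (trans (sym (fce-∷ᵖ c u)) (trans same-fce (fce-∷ᵖ d v))))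

  -- Suffix ranks

  indicator-mono : ∀ {a b} → (T a → T b) → (if a then 1 else 0) ≤ (if b then 1 else 0)
  indicator-mono {false} _ = z≤n
  indicator-mono {true} {true} _ = ≤-refl
  indicator-mono {true} {false} a⇒b = contradiction _ a⇒b

  countUpTo-mono : ∀ n {f g} → (∀ j → T (f j) → T (g j)) → countUpTo n f ≤ countUpTo n g
  countUpTo-mono zero f⇒g = z≤n
  countUpTo-mono (suc n) f⇒g = +-mono-≤ (indicator-mono (f⇒g (suc n))) (countUpTo-mono n f⇒g)

  countUpTo-strictMono : ∀ n {f g i} → (∀ j → T (f j) → T (g j)) →
    1 ≤ i → i ≤ n → ¬ T (f i) → T (g i) → countUpTo n f < countUpTo n g
  countUpTo-strictMono (suc n) {f} {g} f⇒g 1≤i i≤1+n ¬fi gi with m≤n⇒m<n∨m≡n i≤1+n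
  ... | inj₁ (s≤s i≤n) =
    +-mono-≤-< (indicator-mono (f⇒g (suc n))) (countUpTo-strictMono n f⇒g 1≤i i≤n ¬fi gi)
  ... | inj₂ refl with f (suc n) | g (suc n)
  ...   | false | true = s≤s (countUpTo-mono n f⇒g)
  ...   | true  | _    = contradiction _ ¬fi
  countUpTo-strictMono zero _ (s≤s _) ()

  countUpTo-true : ∀ n → countUpTo n (λ _ → true) ≡ n
  countUpTo-true zero = refl
  countUpTo-true (suc n) = cong suc (countUpTo-true n)

  encodeFrom-length : ∀ rev u → length (encodeFrom rev u) ≡ length u
  encodeFrom-length rev [] = refl
  encodeFrom-length rev (inj₁ a ∷ u) = cong suc (encodeFrom-length (inj₁ a ∷ rev) u)
  encodeFrom-length rev (inj₂ c ∷ u) = begin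
    length (encodeFrom rev (inj₂ c ∷ u))  ≡⟨ cong length (encodeFrom-∷ᵖ rev c u) ⟩
    suc (length (encodeFrom (inj₂ c ∷ rev) u)) ≡⟨ cong suc (encodeFrom-length (inj₂ c ∷ rev) u) ⟩
    suc (length u) ∎
    where open ≡-Reasoning

  module Ranks (t : PStr) where

    IsPos : ℕ → Set
    IsPos p = 1 ≤ p × p ≤ length t

    below : ℕ → ℕ → Bool
    below p j = lexLt ⟨ suf t j ⟩ ⟨ suf t p ⟩

    ¬below-self : ∀ p → ¬ T (below p p)
    ¬below-self p = <ˡ-irrefl ⟨ suf t p ⟩ ∘ lexLt⇒<ˡ

    R-mono : ∀ {p q} → IsPos p → ⟨ suf t p ⟩ <ˡ ⟨ suf t q ⟩ → R t p < R t q
    R-mono {p} {q} (1≤p , p≤n) p<q = s≤s (countUpTo-strictMono (length t) {below p} {below q}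
      (λ j j<p → <ˡ⇒lexLt (<ˡ-trans (lexLt⇒<ˡ {⟨ suf t j ⟩} j<p) p<q))
      1≤p p≤n (¬below-self p) (<ˡ⇒lexLt p<q))

    R-≤ : ∀ {p} → IsPos p → R t p ≤ length t
    R-≤ {p} (1≤p , p≤n) = subst (countUpTo (length t) (below p) <_) (countUpTo-true (length t))
      (countUpTo-strictMono (length t) {below p} (λ _ _ → _) 1≤p p≤n (¬below-self p) _)

    ⟨suf⟩-injective : ∀ {p q} → IsPos p → IsPos q → ⟨ suf t p ⟩ ≡ ⟨ suf t q ⟩ → p ≡ q
    ⟨suf⟩-injective {suc a} {suc b} (_ , a<n) (_ , b<n) same =
      cong suc (∸-cancelˡ-≡ (<⇒≤ a<n) (<⇒≤ b<n) (begin
      length t ∸ a             ≡⟨ length-drop a t ⟨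
      length (drop a t)        ≡⟨ encodeFrom-length [] (drop a t) ⟨
      length ⟨ drop a t ⟩      ≡⟨ cong length same ⟩
      length ⟨ drop b t ⟩      ≡⟨ encodeFrom-length [] (drop b t) ⟩
      length (drop b t)        ≡⟨ length-drop b t ⟩
      length t ∸ b ∎))
      where open ≡-Reasoning

    R-injective : ∀ {p q} → IsPos p → IsPos q → R t p ≡ R t q → p ≡ q
    R-injective {p} {q} p-pos q-pos same with <ˡ-compare ⟨ suf t p ⟩ ⟨ suf t q ⟩
    ... | tri< p<q _ _ = contradiction same (<⇒≢ (R-mono {p} {q} p-pos p<q))
    ... | tri≈ _ p≋q _ = ⟨suf⟩-injective p-pos q-pos (Pointwise-≡⇒≡ p≋q)
    ... | tri> _ _ q<p = contradiction (sym same) (<⇒≢ (R-mono {q} {p} q-pos q<p))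

    R-reflects-< : ∀ {p q} → IsPos p → IsPos q → R t p < R t q → ⟨ suf t p ⟩ <ˡ ⟨ suf t q ⟩
    R-reflects-< {p} {q} p-pos q-pos Rp<Rq with <ˡ-compare ⟨ suf t p ⟩ ⟨ suf t q ⟩
    ... | tri< p<q _ _ = p<q
    ... | tri≈ _ p≋q _ =
      contradiction (cong (R t) (⟨suf⟩-injective p-pos q-pos (Pointwise-≡⇒≡ p≋q))) (<⇒≢ Rp<Rq)
    ... | tri> _ _ q<p = contradiction (R-mono {q} {p} q-pos q<p) (<-asym Rp<Rq)

    findRank-R : ∀ n {p} → IsPos p → p ≤ n → n ≤ length t → findRank t (R t p) n ≡ p
    findRank-R (suc n) {p} p-pos p≤1+n 1+n≤len with R t (suc n) ≡ᵇ R t p in found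
    ... | true = R-injective (s≤s z≤n , 1+n≤len) p-pos (≡ᵇ⇒≡ _ _ (subst T (sym found) _))
    ... | false = findRank-R n p-pos (s≤s⁻¹ (≤∧≢⇒< p≤1+n p≢1+n)) (<⇒≤ 1+n≤len)
      where
      p≢1+n : p ≢ suc n
      p≢1+n refl = subst T found (≡⇒≡ᵇ (R t p) (R t p) refl)
    findRank-R zero (s≤s _ , _) () _

    Rinv-R : ∀ {p} → IsPos p → Rinv t (R t p) ≡ p
    Rinv-R p-pos = findRank-R (length t) p-pos (proj₂ p-pos) ≤-refl

    finPos : (k : Fin (length t)) → IsPos (suc (toℕ k))
    finPos k = s≤s z≤n , toℕ<n k

    rankFin : Fin (length t) → Fin (length t)
    rankFin k = fromℕ< (R-≤ (finPos k))

    rankFin-injective : Injective _≡_ _≡_ rankFin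
    rankFin-injective {k} {l} same = toℕ-injective (suc-injective (R-injective (finPos k) (finPos l)
      (cong suc (fromℕ<-injective _ _ (R-≤ (finPos k)) (R-≤ (finPos l)) same))))

    R-surjective : ∀ {r} → 1 ≤ r → r ≤ length t → ∃ λ p → IsPos p × R t p ≡ r
    R-surjective {suc r} _ r<n with Fin-injective⇒surjective rankFin rankFin-injective (fromℕ< r<n)
    ... | k , rank-k = suc (toℕ k) , finPos k , cong suc (begin
      countUpTo (length t) (below (suc (toℕ k)))  ≡⟨ toℕ-fromℕ< (R-≤ (finPos k)) ⟨
      toℕ (rankFin k)                             ≡⟨ cong toℕ rank-k ⟩
      toℕ (fromℕ< r<n)                            ≡⟨ toℕ-fromℕ< r<n ⟩
      r ∎)
      where open ≡-Reasoning

    L-R : ∀ {p} → IsPos p → L t (R t p) ≡ fce (suf₀ t (p ∸ 1))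
    L-R p-pos = cong (λ p → fce (suf₀ t (p ∸ 1))) (Rinv-R p-pos)

    LF-R : ∀ {a} → IsPos (suc (suc a)) → LF t (R t (suc (suc a))) ≡ R t (suc a)
    LF-R p-pos rewrite Rinv-R p-pos = refl

    R-∷-mono : ∀ {a b} → a < length t → b < length t → fce (drop a t) ≡ fce (drop b t) →
      ⟨ drop (suc a) t ⟩ <ˡ ⟨ drop (suc b) t ⟩ → R t (suc a) < R t (suc b)
    R-∷-mono {a} {b} a<n b<n same-fce tail< with drop-∷ a t a<n | drop-∷ b t b<n
    ... | x , split-a | y , split-b = R-mono {suc a} {suc b} (s≤s z≤n , a<n)
      (subst₂ _<ˡ_ (cong ⟨_⟩ (sym split-a)) (cong ⟨_⟩ (sym split-b))
        (⟨⟩-∷-mono x y _ _ (subst₂ (λ u v → fce u ≡ fce v) split-a split-b same-fce) tail<))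

  fce-drop-≢$ : ∀ {w} → inj₁ $ ∉ w → ∀ a → a < length w → fce (drop a (w ++ [ inj₁ $ ])) ≢ inj₁ $
  fce-drop-≢$ {inj₁ _ ∷ _} $∉w zero _ refl = $∉w (here refl)
  fce-drop-≢$ {_ ∷ _} $∉w (suc a) (s≤s a<n) = fce-drop-≢$ ($∉w ∘ there) a a<n

  module _ (w : PStr) ($∉w : inj₁ $ ∉ w) where
    open Ranks (w ++ [ inj₁ $ ])

    private
      t = w ++ [ inj₁ $ ]

      length-t : length t ≡ suc (length w)
      length-t = trans (length-++ w) (+-comm (length w) 1)

    LF-R-mono : ∀ {p q} → IsPos p → IsPos q → R t p < R t q →
      fce (suf₀ t (p ∸ 1)) ≡ fce (suf₀ t (q ∸ 1)) → LF t (R t p) < LF t (R t q)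
    LF-R-mono {1} {1} _ _ Rp<Rq _ = contradiction refl (<⇒≢ Rp<Rq)
    LF-R-mono {1} {suc (suc b)} _ (_ , q≤n) _ same-fce =
      contradiction (sym same-fce) (fce-drop-≢$ $∉w b (s≤s⁻¹ (subst (suc (suc b) ≤_) length-t q≤n)))
    LF-R-mono {suc (suc a)} {1} (_ , p≤n) _ _ same-fce =
      contradiction same-fce (fce-drop-≢$ $∉w a (s≤s⁻¹ (subst (suc (suc a) ≤_) length-t p≤n)))
    LF-R-mono {suc (suc a)} {suc (suc b)} p-pos q-pos Rp<Rq same-fce
      rewrite LF-R p-pos | LF-R q-pos =
      R-∷-mono (<⇒≤ (proj₂ p-pos)) (<⇒≤ (proj₂ q-pos)) same-fce (R-reflects-< p-pos q-pos Rp<Rq)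

    LF-order : ∀ i j → 1 ≤ i → i < j → j ≤ length t → L t i ≡ L t j → LF t i < LF t j
    LF-order i j 1≤i i<j j≤n same-L
      with p , p-pos , refl ← R-surjective 1≤i (≤-trans (<⇒≤ i<j) j≤n)
         | q , q-pos , refl ← R-surjective (≤-trans 1≤i (<⇒≤ i<j)) j≤n
      = LF-R-mono p-pos q-pos i<j (trans (sym (L-R p-pos)) (trans same-L (L-R q-pos)))

corollary4 : (S : Set) (_<ₛ_ : S → S → Set) (sto : IsStrictTotalOrder _≡_ _<ₛ_)
    ($ : S) → (∀ a → ¬ (a <ₛ $))
    → (P : Set) (_≟ₚ_ : DecidableEquality P)
    → let open PString S _<ₛ_ sto $ P _≟ₚ_ in
    (T : PStr) → (w : PStr) → T ≡ w ++ [ inj₁ $ ] → inj₁ $ ∉ w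
    → (i j : ℕ) → 1 ≤ i → i < j → j ≤ length T
    → L T i ≡ L T j → LF T i < LF T j
corollary4 S _<ₛ_ sto $ _ P _≟ₚ_ _ w refl $∉w = PStringProperties.LF-order S _<ₛ_ sto $ P _≟ₚ_ w $∉w
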